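{- For every $n\geq 0$ and every word $v$ of length $n$ beginning with the letter $a$, $$|\psi(v)|_b\leq|\psi(v^{(n)})|_b=F_{n-1}-1,$$ and equality holds if and only if $v=v^{(n)}$ or $v=E(d(v^{(n)}))$.
   Context: Let $\mathcal{A}=\{a,b\}$. $|w|_b$ is the number of occurrences of $b$ in $w$. $w^{(+)}$ is the shortest palindrome having $w$ as a prefix; $\psi(\varepsilon)=\varepsilon$, $\psi(vx)=(\psi(v)x)^{(+)}$ for $v\in\mathcal{A}^*$, $x\in\mathcal{A}$. $v^{(n)}$ is the prefix of length $n$ of $(ab)^\omega$. $E$ is the automorphism exchanging $a$ and $b$. The operator $d$ on $\mathcal{A}^*$ is defined by $d(\varepsilon)=\varepsilon$, $d(x)=x$ for $x\in\mathcal{A}$, and $d(xyu)=yxu$ for $x,y\in\mathcal{A}$, $u\in\mathcal{A}^*$ (it swaps the first two letters). Fibonacci numbers: $F_{ -1}=F_0=1$, $F_{n+1}=F_n+F_{n-1}$. -}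

module Defs where

open import Data.Nat using (ℕ; zero; suc; _+_)
open import Data.Nat using (_%_)
open import Data.Bool using (Bool; true; false; if_then_else_)
open import Data.List using (List; []; _∷_; _++_; [_]; reverse; take; length; map; foldl; upTo)
open import Data.List.Properties using (≡-dec)
open import Relation.Binary.PropositionalEquality using (_≡_; refl)
open import Relation.Nullary using (Dec; yes; no; does)

data Letter : Set where
  a b : Letter

_≟L_ : (x y : Letter) → Dec (x ≡ y)
a ≟L a = yes refl
a ≟L b = no (λ ())
b ≟L a = no (λ ())
b ≟L b = yes refl

Word : Set
Word = List Letter

_≟W_ : (u w : Word) → Dec (u ≡ w)
_≟W_ = ≡-dec _≟L_

count-b : Word → ℕ
count-b [] = 0
count-b (a ∷ w) = count-b w
count-b (b ∷ w) = suc (count-b w)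

isPalindrome? : (w : Word) → Dec (w ≡ reverse w)
isPalindrome? w = w ≟W reverse w

-- Any word of length |w| + k having w as a prefix and being a palindrome
-- equals w ++ reverse (take k w).  The shortest palindrome having w as a prefix
-- is therefore w ++ reverse (take k w) for the least k for which this is a
-- palindrome; k = |w| always works, so the search (with fuel |w|) is total.
private
  search : ℕ → ℕ → Word → Word
  search k zero w = w ++ reverse (take k w)
  search k (suc fuel) w =
    if does (isPalindrome? (w ++ reverse (take k w)))
    then w ++ reverse (take k w)
    else search (suc k) fuel w

palClosure : Word → Word
palClosure w = search 0 (length w) w

ψ : Word → Word
ψ = foldl (λ acc x → palClosure (acc ++ [ x ])) []

abω : ℕ → Letter
abω i with i % 2
... | zero = a
... | suc _ = b

v⁽_⁾ : ℕ → Word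
v⁽ n ⁾ = map abω (upTo n)

swapL : Letter → Letter
swapL a = b
swapL b = a

E : Word → Word
E = map swapL

d : Word → Word
d [] = []
d (x ∷ []) = x ∷ []
d (x ∷ y ∷ u) = y ∷ x ∷ u

-- Fm1 n = F_{n-1}, where F_{-1} = F_0 = 1, F_{k+1} = F_k + F_{k-1}
Fm1 : ℕ → ℕ
Fm1 zero = 1
Fm1 (suc zero) = 1
Fm1 (suc (suc n)) = Fm1 (suc n) + Fm1 n

-- Justin's formula ψ(x w) = μ_x(ψ(w)) x holds for the morphism μ_x : x ↦ x, y ↦ x y: the map
-- u ↦ μ_x(u) x commutes with reversal and carries the longest palindromic suffix of u to that of
-- μ_x(u) x (of μ_x(u) when u ends with y), so it commutes with each step w ↦ (w c)^(+) of ψ.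
-- Consequently (|ψ(w)|_a + 1, |ψ(w)|_b + 1) is obtained from (1, 1) by reading w from right to
-- left and applying (p, q) ↦ (p + q, q) for a and (p, q) ↦ (p, p + q) for b.  Both entries of
-- this pair are bounded by F_{|w|}, their sum by F_{|w|+1}, and the sum bound is attained only by
-- alternating words.  For v = a w the b-entry is that of w, which is maximal exactly when w is
-- empty or w = b w′ with w′ alternating.
module Submission where

open import Defs
open import Data.Nat using (ℕ; zero; suc; _+_; _∸_; _≤_; _<_; z≤n; s≤s)
open import Data.Nat.Properties
  using (≤-trans; ≤-reflexive; ≤-antisym; <⇒≤; <-irrefl; ≤-<-trans; ≤-pred; ≮⇒≥; m≤n⇒m<n∨m≡n;
         1+n≰n; m+1+n≰m; m⊓n≤m; m≤m+n; m<m+n; suc-injective; +-identityʳ; +-suc; +-comm;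
         +-mono-≤; +-monoʳ-≤; +-cancelˡ-≡; +-cancelʳ-≤)
open import Data.List
  using ([]; _∷_; _++_; [_]; reverse; take; drop; length; head; foldl; applyUpTo)
open import Data.List.Properties
  using (∷-injective; ∷-injectiveˡ; ∷-injectiveʳ; ∷ʳ-injectiveˡ; ++-assoc; ++-identityʳ;
         ++-cancelˡ; ++-cancelʳ; length-++; length-++-≤ˡ; length-++-comm; length-take;
         take++drop≡id; drop-all; reverse-++; reverse-involutive; map-applyUpTo)
open import Data.Maybe using (just)
open import Data.Product using (Σ-syntax; ∃₂; _×_; _,_; proj₁; proj₂)
open import Data.Sum using (_⊎_; inj₁; inj₂)
open import Data.Empty using (⊥-elim)
open import Function using (_∘_)
open import Function.Bundles using (_⇔_; mk⇔; Equivalence)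
open import Function.Properties.Equivalence using () renaming (trans to ⇔-trans)
open import Relation.Nullary using (¬_; yes; no)
open import Relation.Binary.PropositionalEquality
  using (_≡_; _≢_; refl; sym; trans; cong; cong₂; subst; subst₂; module ≡-Reasoning)
open ≡-Reasoning

Palindrome : Word → Set
Palindrome w = w ≡ reverse w

reverse-sandwich : ∀ (u s : Word) → reverse (u ++ s ++ reverse u) ≡ u ++ reverse s ++ reverse u
reverse-sandwich u s = begin
  reverse (u ++ s ++ reverse u)                    ≡⟨ reverse-++ u (s ++ reverse u) ⟩
  reverse (s ++ reverse u) ++ reverse u            ≡⟨ cong (_++ reverse u) (reverse-++ s (reverse u)) ⟩
  (reverse (reverse u) ++ reverse s) ++ reverse u  ≡⟨ cong (λ t → (t ++ reverse s) ++ reverse u)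
                                                           (reverse-involutive u) ⟩
  (u ++ reverse s) ++ reverse u                    ≡⟨ ++-assoc u (reverse s) (reverse u) ⟩
  u ++ reverse s ++ reverse u                      ∎

sandwich-palindrome⁺ : ∀ u {s} → Palindrome s → Palindrome (u ++ s ++ reverse u)
sandwich-palindrome⁺ u {s} pal =
  trans (cong (λ t → u ++ t ++ reverse u) pal) (sym (reverse-sandwich u s))

sandwich-palindrome⁻ : ∀ u {s} → Palindrome (u ++ s ++ reverse u) → Palindrome s
sandwich-palindrome⁻ u {s} pal =
  ++-cancelʳ (reverse u) s (reverse s) (++-cancelˡ u _ _ (trans pal (reverse-sandwich u s)))

palindromic-suffix-head : ∀ {w w₀ e p c r} → w ≡ w₀ ++ [ e ] → w ≡ p ++ c ∷ r →
                          Palindrome (c ∷ r) → c ≡ e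
palindromic-suffix-head {w₀ = w₀} {e} {p} {c} {r} w≡w₀e w≡pcr pal = ∷-injectiveˡ (begin
  c ∷ r ++ reverse p            ≡⟨ cong (_++ reverse p) pal ⟩
  reverse (c ∷ r) ++ reverse p  ≡⟨ reverse-++ p (c ∷ r) ⟨
  reverse (p ++ c ∷ r)          ≡⟨ cong reverse (trans (sym w≡pcr) w≡w₀e) ⟩
  reverse (w₀ ++ [ e ])         ≡⟨ reverse-++ w₀ [ e ] ⟩
  e ∷ reverse w₀                ∎)

drop-length-++ : ∀ (p : Word) {s} → drop (length p) (p ++ s) ≡ s
drop-length-++ []      = refl
drop-length-++ (c ∷ p) = drop-length-++ p

++-prefix : ∀ (p p′ : Word) {s s′} → p ++ s ≡ p′ ++ s′ → length p ≤ length p′ →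
            Σ[ m ∈ Word ] p′ ≡ p ++ m
++-prefix []      p′        _  _        = p′ , refl
++-prefix (c ∷ p) (c′ ∷ p′) eq (s≤s le) with ∷-injective eq
... | refl , eq′ with ++-prefix p p′ eq′ le
...   | m , refl = m , refl

record LongestPalSuffix (w p s : Word) : Set where
  field
    split      : w ≡ p ++ s
    palindrome : Palindrome s
    longest    : ∀ p′ s′ → w ≡ p′ ++ s′ → Palindrome s′ → length p ≤ length p′

open LongestPalSuffix

longestPalSuffix-intro : ∀ {w w₀ e p s} → w ≡ w₀ ++ [ e ] → w ≡ p ++ s → Palindrome s →
  (∀ p′ r → w ≡ p′ ++ e ∷ r → Palindrome (e ∷ r) → length p ≤ length p′) →
  LongestPalSuffix w p s
longestPalSuffix-intro {w} {p = p} {s} w≡w₀e w≡ps pal longest-nonempty =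
  record { split = w≡ps ; palindrome = pal ; longest = shortest-prefix }
  where
  shortest-prefix : ∀ p′ s′ → w ≡ p′ ++ s′ → Palindrome s′ → length p ≤ length p′
  shortest-prefix p′ [] w≡p′ _ = ≤-trans (length-++-≤ˡ p)
    (≤-reflexive (cong length (trans (sym w≡ps) (trans w≡p′ (++-identityʳ p′)))))
  shortest-prefix p′ (c ∷ r) w≡p′cr pal′ with palindromic-suffix-head w≡w₀e w≡p′cr pal′
  ... | refl = longest-nonempty p′ r w≡p′cr pal′

longestPalSuffix-head : ∀ {w₀ e p s} → LongestPalSuffix (w₀ ++ [ e ]) p s →
                        Σ[ s₀ ∈ Word ] s ≡ e ∷ s₀
longestPalSuffix-head {w₀} {e} {p} {[]} L =
  ⊥-elim (1+n≰n (≤-trans (≤-reflexive |w₀e|≡|p|) (longest L w₀ [ e ] refl refl)))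
  where
  |w₀e|≡|p| : suc (length w₀) ≡ length p
  |w₀e|≡|p| = trans (sym (length-++-comm w₀ [ e ])) (cong length (trans (split L) (++-identityʳ p)))
longestPalSuffix-head {s = c ∷ s₀} L =
  s₀ , cong (_∷ s₀) (palindromic-suffix-head refl (split L) (palindrome L))

-- The search loop behind palClosure is private to Defs; this meta is solved to it by
-- unification with the unfolding of palClosure.
mutual
  palSearch : ℕ → ℕ → Word → Word
  palSearch = _

  palClosure-search : ∀ w → palClosure w ≡ palSearch 0 (length w) w
  palClosure-search w with length w
  ... | n with 0
  ...   | k = refl

closing-split : ∀ j (w : Word) →
                w ++ reverse (take j w) ≡ take j w ++ drop j w ++ reverse (take j w)
closing-split j w = trans (cong (_++ reverse (take j w)) (sym (take++drop≡id j w)))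
                          (++-assoc (take j w) (drop j w) _)

closing-palindrome⇔ : ∀ j w → Palindrome (w ++ reverse (take j w)) ⇔ Palindrome (drop j w)
closing-palindrome⇔ j w = mk⇔
  (sandwich-palindrome⁻ (take j w) ∘ subst Palindrome (closing-split j w))
  (subst Palindrome (sym (closing-split j w)) ∘ sandwich-palindrome⁺ (take j w))

NoPalSuffixBefore : Word → ℕ → Set
NoPalSuffixBefore w k = ∀ j → j < k → ¬ Palindrome (drop j w)

palSearch-spec : ∀ fuel k w → k + fuel ≡ length w → NoPalSuffixBefore w k →
  Σ[ j ∈ ℕ ] Palindrome (drop j w) × NoPalSuffixBefore w j
             × palSearch k fuel w ≡ w ++ reverse (take j w)
palSearch-spec zero k w k≡|w| none = k , drop-palindrome , none , refl
  where
  drop-palindrome : Palindrome (drop k w)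
  drop-palindrome = subst Palindrome
    (sym (drop-all k w (≤-reflexive (sym (trans (sym (+-identityʳ k)) k≡|w|))))) refl
palSearch-spec (suc fuel) k w k+fuel≡|w| none with isPalindrome? (w ++ reverse (take k w))
... | yes pal = k , Equivalence.to (closing-palindrome⇔ k w) pal , none , refl
... | no ¬pal = palSearch-spec fuel (suc k) w (trans (sym (+-suc k fuel)) k+fuel≡|w|) none′
  where
  none′ : NoPalSuffixBefore w (suc k)
  none′ j (s≤s j≤k) with m≤n⇒m<n∨m≡n j≤k
  ... | inj₁ j<k  = none j j<k
  ... | inj₂ refl = ¬pal ∘ Equivalence.from (closing-palindrome⇔ j w)

palClosure-spec : ∀ w → Σ[ j ∈ ℕ ]
  LongestPalSuffix w (take j w) (drop j w) × palClosure w ≡ w ++ reverse (take j w)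
palClosure-spec w with palSearch-spec (length w) 0 w refl (λ _ ())
... | j , pal , none , closure =
  j , record { split = sym (take++drop≡id j w) ; palindrome = pal ; longest = shortest-prefix } ,
  trans (palClosure-search w) closure
  where
  shortest-prefix : ∀ p′ s′ → w ≡ p′ ++ s′ → Palindrome s′ → length (take j w) ≤ length p′
  shortest-prefix p′ s′ w≡p′s′ pal′ =
    ≤-trans (≤-reflexive (length-take j w)) (≤-trans (m⊓n≤m j (length w)) (≮⇒≥ λ |p′|<j →
      none (length p′) |p′|<j
        (subst Palindrome (sym (trans (cong (drop (length p′)) w≡p′s′) (drop-length-++ p′))) pal′)))

longestPalSuffix : ∀ w → ∃₂ λ p s → LongestPalSuffix w p s
longestPalSuffix w with palClosure-spec w
... | j , L , _ = take j w , drop j w , L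

longestPalSuffix-unique : ∀ {w p s p′ s′} → LongestPalSuffix w p s → LongestPalSuffix w p′ s′ →
                          p ≡ p′
longestPalSuffix-unique {p = p} {p′ = p′} L L′
  with ++-prefix p p′ (trans (sym (split L)) (split L′)) (longest L _ _ (split L′) (palindrome L′))
... | []    , p′≡p   = sym (trans p′≡p (++-identityʳ p))
... | c ∷ m , p′≡pcm = ⊥-elim (m+1+n≰m (length p)
  (subst (_≤ length p) (trans (cong length p′≡pcm) (length-++ p))
         (longest L′ _ _ (split L) (palindrome L))))

palClosure-longest : ∀ {w p s} → LongestPalSuffix w p s → palClosure w ≡ w ++ reverse p
palClosure-longest {w} L with palClosure-spec w
... | j , L′ , closure = trans closure (cong (λ t → w ++ reverse t) (longestPalSuffix-unique L′ L))

μ-letter : Letter → Letter → Word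
μ-letter a a = a ∷ []
μ-letter a b = a ∷ b ∷ []
μ-letter b b = b ∷ []
μ-letter b a = b ∷ a ∷ []

μ : Letter → Word → Word
μ x []      = []
μ x (c ∷ u) = μ-letter x c ++ μ x u

μ⁺ : Letter → Word → Word
μ⁺ x u = μ x u ++ [ x ]

μ-self : ∀ x u → μ x (x ∷ u) ≡ x ∷ μ x u
μ-self a u = refl
μ-self b u = refl

μ-other : ∀ x u → μ x (swapL x ∷ u) ≡ x ∷ swapL x ∷ μ x u
μ-other a u = refl
μ-other b u = refl

μ-++ : ∀ x u v → μ x (u ++ v) ≡ μ x u ++ μ x v
μ-++ x []      v = refl
μ-++ x (c ∷ u) v = trans (cong (μ-letter x c ++_) (μ-++ x u v))
                         (sym (++-assoc (μ-letter x c) (μ x u) (μ x v)))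

μ-snoc : ∀ x u c → μ x (u ++ [ c ]) ≡ μ x u ++ μ-letter x c
μ-snoc x u c = trans (μ-++ x u [ c ]) (cong (μ x u ++_) (++-identityʳ (μ-letter x c)))

μ-letter-conjugate : ∀ x c → μ-letter x c ++ [ x ] ≡ x ∷ reverse (μ-letter x c)
μ-letter-conjugate a a = refl
μ-letter-conjugate a b = refl
μ-letter-conjugate b b = refl
μ-letter-conjugate b a = refl

reverse-μ⁺ : ∀ x u → reverse (μ⁺ x u) ≡ μ⁺ x (reverse u)
reverse-μ⁺ x []      = refl
reverse-μ⁺ x (c ∷ u) = begin
  reverse ((μc ++ μ x u) ++ [ x ])          ≡⟨ cong reverse (++-assoc μc (μ x u) [ x ]) ⟩
  reverse (μc ++ μ⁺ x u)                    ≡⟨ reverse-++ μc (μ⁺ x u) ⟩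
  reverse (μ⁺ x u) ++ reverse μc            ≡⟨ cong (_++ reverse μc) (reverse-μ⁺ x u) ⟩
  (μ x (reverse u) ++ [ x ]) ++ reverse μc  ≡⟨ ++-assoc (μ x (reverse u)) [ x ] (reverse μc) ⟩
  μ x (reverse u) ++ x ∷ reverse μc         ≡⟨ cong (μ x (reverse u) ++_) (μ-letter-conjugate x c) ⟨
  μ x (reverse u) ++ μc ++ [ x ]            ≡⟨ ++-assoc (μ x (reverse u)) μc [ x ] ⟨
  (μ x (reverse u) ++ μc) ++ [ x ]          ≡⟨ cong (_++ [ x ]) (μ-snoc x (reverse u) c) ⟨
  μ⁺ x (reverse u ++ [ c ])                 ≡⟨ cong (μ⁺ x) (reverse-++ [ c ] u) ⟨
  μ⁺ x (reverse (c ∷ u))                    ∎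
  where
  μc : Word
  μc = μ-letter x c

μ-head : ∀ x u {w} → μ x u ≢ swapL x ∷ w
μ-head x []      ()
μ-head a (a ∷ u) ()
μ-head a (b ∷ u) ()
μ-head b (b ∷ u) ()
μ-head b (a ∷ u) ()

μ-injective : ∀ x u v → μ x u ≡ μ x v → u ≡ v
μ-injective x []      []      _  = refl
μ-injective a []      (a ∷ v) ()
μ-injective a []      (b ∷ v) ()
μ-injective b []      (a ∷ v) ()
μ-injective b []      (b ∷ v) ()
μ-injective a (a ∷ u) []      ()
μ-injective a (b ∷ u) []      ()
μ-injective b (a ∷ u) []      ()
μ-injective b (b ∷ u) []      ()
μ-injective a (a ∷ u) (a ∷ v) eq = cong (a ∷_) (μ-injective a u v (∷-injectiveʳ eq))
μ-injective a (b ∷ u) (b ∷ v) eq = cong (b ∷_) (μ-injective a u v (∷-injectiveʳ (∷-injectiveʳ eq)))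
μ-injective b (b ∷ u) (b ∷ v) eq = cong (b ∷_) (μ-injective b u v (∷-injectiveʳ eq))
μ-injective b (a ∷ u) (a ∷ v) eq = cong (a ∷_) (μ-injective b u v (∷-injectiveʳ (∷-injectiveʳ eq)))
μ-injective a (a ∷ u) (b ∷ v) eq = ⊥-elim (μ-head a u (∷-injectiveʳ eq))
μ-injective a (b ∷ u) (a ∷ v) eq = ⊥-elim (μ-head a v (sym (∷-injectiveʳ eq)))
μ-injective b (b ∷ u) (a ∷ v) eq = ⊥-elim (μ-head b u (∷-injectiveʳ eq))
μ-injective b (a ∷ u) (b ∷ v) eq = ⊥-elim (μ-head b v (sym (∷-injectiveʳ eq)))

μ⁺-palindrome⁺ : ∀ x {s} → Palindrome s → Palindrome (μ⁺ x s)
μ⁺-palindrome⁺ x {s} pal = trans (cong (μ⁺ x) pal) (sym (reverse-μ⁺ x s))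

μ⁺-palindrome⁻ : ∀ x {s} → Palindrome (μ⁺ x s) → Palindrome s
μ⁺-palindrome⁻ x {s} pal = μ-injective x s (reverse s)
  (∷ʳ-injectiveˡ (μ x s) (μ x (reverse s)) (trans pal (reverse-μ⁺ x s)))

CutPreimage : Letter → Word → Word → Word → Set
CutPreimage x u P R = ∃₂ λ p s → u ≡ p ++ s × P ≡ μ x p × x ∷ R ≡ μ⁺ x s

cutPreimage-∷ : ∀ x c {u P R} → CutPreimage x u P R →
                CutPreimage x (c ∷ u) (μ-letter x c ++ P) R
cutPreimage-∷ x c (p , s , u≡ps , P≡μp , xR≡μ⁺s) =
  c ∷ p , s , cong (c ∷_) u≡ps , cong (μ-letter x c ++_) P≡μp , xR≡μ⁺s

μ⁺-cut-before-self : ∀ x u {P R} → μ⁺ x u ≡ P ++ x ∷ R → CutPreimage x u P R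
μ⁺-cut-before-self x []      {[]}        refl = [] , [] , refl , refl , refl
μ⁺-cut-before-self x []      {_ ∷ []}    ()
μ⁺-cut-before-self x []      {_ ∷ _ ∷ _} ()
μ⁺-cut-before-self x (c ∷ u) {[]}        eq   = [] , c ∷ u , refl , refl , sym eq
μ⁺-cut-before-self a (a ∷ u) {_ ∷ P}     eq with ∷-injective eq
... | refl , eq′ = cutPreimage-∷ a a (μ⁺-cut-before-self a u eq′)
μ⁺-cut-before-self b (b ∷ u) {_ ∷ P}     eq with ∷-injective eq
... | refl , eq′ = cutPreimage-∷ b b (μ⁺-cut-before-self b u eq′)
μ⁺-cut-before-self a (b ∷ u) {_ ∷ []}    ()
μ⁺-cut-before-self b (a ∷ u) {_ ∷ []}    ()
μ⁺-cut-before-self a (b ∷ u) {_ ∷ _ ∷ P} eq with ∷-injective eq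
... | refl , eq′ with ∷-injective eq′
...   | refl , eq″ = cutPreimage-∷ a b (μ⁺-cut-before-self a u eq″)
μ⁺-cut-before-self b (a ∷ u) {_ ∷ _ ∷ P} eq with ∷-injective eq
... | refl , eq′ with ∷-injective eq′
...   | refl , eq″ = cutPreimage-∷ b a (μ⁺-cut-before-self b u eq″)

μ-cut-before-other : ∀ x u {P R} → μ x u ≡ P ++ swapL x ∷ R → Σ[ P₀ ∈ Word ] P ≡ P₀ ++ [ x ]
μ-cut-before-other x u       {[]}        eq = ⊥-elim (μ-head x u eq)
μ-cut-before-other x []      {_ ∷ _}     ()
μ-cut-before-other a (a ∷ u) {_ ∷ P}     eq with ∷-injective eq
... | refl , eq′ with μ-cut-before-other a u eq′
...   | P₀ , refl = a ∷ P₀ , refl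
μ-cut-before-other b (b ∷ u) {_ ∷ P}     eq with ∷-injective eq
... | refl , eq′ with μ-cut-before-other b u eq′
...   | P₀ , refl = b ∷ P₀ , refl
μ-cut-before-other a (b ∷ u) {_ ∷ []}    refl = [] , refl
μ-cut-before-other b (a ∷ u) {_ ∷ []}    refl = [] , refl
μ-cut-before-other a (b ∷ u) {_ ∷ _ ∷ P} eq with ∷-injective eq
... | refl , eq′ with ∷-injective eq′
...   | refl , eq″ with μ-cut-before-other a u eq″
...     | P₀ , refl = a ∷ b ∷ P₀ , refl
μ-cut-before-other b (a ∷ u) {_ ∷ _ ∷ P} eq with ∷-injective eq
... | refl , eq′ with ∷-injective eq′
...   | refl , eq″ with μ-cut-before-other b u eq″
...     | P₀ , refl = b ∷ a ∷ P₀ , refl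

μ-prefix-length-mono : ∀ x {p p′ s s′} → p ++ s ≡ p′ ++ s′ → length p ≤ length p′ →
                       length (μ x p) ≤ length (μ x p′)
μ-prefix-length-mono x {p} {p′} eq le with ++-prefix p p′ eq le
... | m , refl = ≤-trans (length-++-≤ˡ (μ x p)) (≤-reflexive (cong length (sym (μ-++ x p m))))

μ⁺-++-reverse : ∀ x u p → μ⁺ x (u ++ reverse p) ≡ μ x u ++ reverse (μ⁺ x p)
μ⁺-++-reverse x u p = begin
  μ x (u ++ reverse p) ++ [ x ]          ≡⟨ cong (_++ [ x ]) (μ-++ x u (reverse p)) ⟩
  (μ x u ++ μ x (reverse p)) ++ [ x ]    ≡⟨ ++-assoc (μ x u) (μ x (reverse p)) [ x ] ⟩
  μ x u ++ μ⁺ x (reverse p)              ≡⟨ cong (μ x u ++_) (reverse-μ⁺ x p) ⟨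
  μ x u ++ reverse (μ⁺ x p)              ∎

μ⁺-longestPalSuffix : ∀ x {u p s} → LongestPalSuffix u p s →
                      LongestPalSuffix (μ⁺ x u) (μ x p) (μ⁺ x s)
μ⁺-longestPalSuffix x {u} {p} {s} L =
  longestPalSuffix-intro refl μ⁺-split (μ⁺-palindrome⁺ x (palindrome L)) shortest-prefix
  where
  μ⁺-split : μ⁺ x u ≡ μ x p ++ μ⁺ x s
  μ⁺-split = begin
    μ x u ++ [ x ]              ≡⟨ cong (λ t → μ x t ++ [ x ]) (split L) ⟩
    μ x (p ++ s) ++ [ x ]       ≡⟨ cong (_++ [ x ]) (μ-++ x p s) ⟩
    (μ x p ++ μ x s) ++ [ x ]   ≡⟨ ++-assoc (μ x p) (μ x s) [ x ] ⟩
    μ x p ++ μ⁺ x s             ∎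
  shortest-prefix : ∀ p′ r → μ⁺ x u ≡ p′ ++ x ∷ r → Palindrome (x ∷ r) →
                    length (μ x p) ≤ length p′
  shortest-prefix p′ r eq pal with μ⁺-cut-before-self x u eq
  ... | p″ , s″ , u≡p″s″ , refl , xr≡μ⁺s″ =
    μ-prefix-length-mono x {p} {p″} (trans (sym (split L)) u≡p″s″)
      (longest L p″ s″ u≡p″s″ (μ⁺-palindrome⁻ x (subst Palindrome xr≡μ⁺s″ pal)))

μ⁺-snoc-self : ∀ x z → μ⁺ x z ++ [ x ] ≡ μ⁺ x (z ++ [ x ])
μ⁺-snoc-self x z =
  cong (_++ [ x ]) (sym (trans (μ-++ x z [ x ]) (cong (μ x z ++_) (μ-self x []))))

μ⁺-snoc-other : ∀ x z → μ x (z ++ [ swapL x ]) ≡ μ⁺ x z ++ [ swapL x ]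
μ⁺-snoc-other x z = begin
  μ x (z ++ [ swapL x ])      ≡⟨ μ-++ x z [ swapL x ] ⟩
  μ x z ++ μ x [ swapL x ]    ≡⟨ cong (μ x z ++_) (μ-other x []) ⟩
  μ x z ++ x ∷ swapL x ∷ []   ≡⟨ ++-assoc (μ x z) [ x ] [ swapL x ] ⟨
  μ⁺ x z ++ [ swapL x ]       ∎

-- Every y in μ x u is preceded by x, so a palindromic suffix y r of μ x u extends to the
-- palindromic suffix x y r x of μ⁺ x u, which comes from a palindromic suffix of u.
μ-longestPalSuffix-other : ∀ x {z p s₀} → LongestPalSuffix (z ++ [ swapL x ]) p (swapL x ∷ s₀) →
  LongestPalSuffix (μ x (z ++ [ swapL x ])) (μ⁺ x p) (swapL x ∷ μ x s₀)
μ-longestPalSuffix-other x {z} {p} {s₀} L =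
  longestPalSuffix-intro (μ⁺-snoc-other x z) μ-split palindrome′ shortest-prefix
  where
  y : Letter
  y = swapL x
  u : Word
  u = z ++ [ y ]
  μ-split : μ x u ≡ μ⁺ x p ++ y ∷ μ x s₀
  μ-split = begin
    μ x u                     ≡⟨ cong (μ x) (split L) ⟩
    μ x (p ++ y ∷ s₀)         ≡⟨ μ-++ x p (y ∷ s₀) ⟩
    μ x p ++ μ x (y ∷ s₀)     ≡⟨ cong (μ x p ++_) (μ-other x s₀) ⟩
    μ x p ++ x ∷ y ∷ μ x s₀   ≡⟨ ++-assoc (μ x p) [ x ] (y ∷ μ x s₀) ⟨
    μ⁺ x p ++ y ∷ μ x s₀      ∎
  palindrome′ : Palindrome (y ∷ μ x s₀)
  palindrome′ = sandwich-palindrome⁻ [ x ]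
    (subst Palindrome (cong (_++ [ x ]) (μ-other x s₀)) (μ⁺-palindrome⁺ x (palindrome L)))
  shortest-prefix : ∀ p′ r → μ x u ≡ p′ ++ y ∷ r → Palindrome (y ∷ r) →
                    length (μ⁺ x p) ≤ length p′
  shortest-prefix p′ r eq pal with μ-cut-before-other x u eq
  ... | P₀ , refl with μ⁺-cut-before-self x u {P₀} {y ∷ r ++ [ x ]} (begin
        μ x u ++ [ x ]                     ≡⟨ cong (_++ [ x ]) eq ⟩
        ((P₀ ++ [ x ]) ++ y ∷ r) ++ [ x ]  ≡⟨ cong (_++ [ x ]) (++-assoc P₀ [ x ] (y ∷ r)) ⟩
        (P₀ ++ x ∷ y ∷ r) ++ [ x ]         ≡⟨ ++-assoc P₀ (x ∷ y ∷ r) [ x ] ⟩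
        P₀ ++ x ∷ y ∷ r ++ [ x ]           ∎)
  ... | p″ , s″ , u≡p″s″ , refl , xyrx≡μ⁺s″ =
    subst₂ _≤_ (sym (length-++-comm (μ x p) [ x ])) (sym (length-++-comm (μ x p″) [ x ]))
      (s≤s (μ-prefix-length-mono x {p} {p″} (trans (sym (split L)) u≡p″s″) |p|≤|p″|))
    where
    |p|≤|p″| : length p ≤ length p″
    |p|≤|p″| = longest L p″ s″ u≡p″s″
      (μ⁺-palindrome⁻ x (subst Palindrome xyrx≡μ⁺s″ (sandwich-palindrome⁺ [ x ] pal)))

palClosure-μ⁺ : ∀ x u → palClosure (μ⁺ x u) ≡ μ⁺ x (palClosure u)
palClosure-μ⁺ x u with longestPalSuffix u
... | p , s , L = begin
  palClosure (μ⁺ x u)                  ≡⟨ palClosure-longest (μ⁺-longestPalSuffix x L) ⟩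
  (μ x u ++ [ x ]) ++ reverse (μ x p)  ≡⟨ ++-assoc (μ x u) [ x ] (reverse (μ x p)) ⟩
  μ x u ++ x ∷ reverse (μ x p)         ≡⟨ cong (μ x u ++_) (reverse-++ (μ x p) [ x ]) ⟨
  μ x u ++ reverse (μ⁺ x p)            ≡⟨ μ⁺-++-reverse x u p ⟨
  μ⁺ x (u ++ reverse p)                ≡⟨ cong (μ⁺ x) (palClosure-longest L) ⟨
  μ⁺ x (palClosure u)                  ∎

palClosure-μ-snoc-other : ∀ x z →
  palClosure (μ x (z ++ [ swapL x ])) ≡ μ⁺ x (palClosure (z ++ [ swapL x ]))
palClosure-μ-snoc-other x z with longestPalSuffix (z ++ [ swapL x ])
... | p , s , L with longestPalSuffix-head L
...   | s₀ , refl = begin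
  palClosure (μ x u)          ≡⟨ palClosure-longest (μ-longestPalSuffix-other x L) ⟩
  μ x u ++ reverse (μ⁺ x p)   ≡⟨ μ⁺-++-reverse x u p ⟨
  μ⁺ x (u ++ reverse p)       ≡⟨ cong (μ⁺ x) (palClosure-longest L) ⟨
  μ⁺ x (palClosure u)         ∎
  where
  u : Word
  u = z ++ [ swapL x ]

closeWith : Word → Letter → Word
closeWith w c = palClosure (w ++ [ c ])

closeWith-μ⁺ : ∀ x c z → closeWith (μ⁺ x z) c ≡ μ⁺ x (closeWith z c)
closeWith-μ⁺ a a z = trans (cong palClosure (μ⁺-snoc-self a z)) (palClosure-μ⁺ a (z ++ [ a ]))
closeWith-μ⁺ b b z = trans (cong palClosure (μ⁺-snoc-self b z)) (palClosure-μ⁺ b (z ++ [ b ]))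
closeWith-μ⁺ a b z = trans (cong palClosure (sym (μ⁺-snoc-other a z))) (palClosure-μ-snoc-other a z)
closeWith-μ⁺ b a z = trans (cong palClosure (sym (μ⁺-snoc-other b z))) (palClosure-μ-snoc-other b z)

foldl-closeWith-μ⁺ : ∀ x w z → foldl closeWith (μ⁺ x z) w ≡ μ⁺ x (foldl closeWith z w)
foldl-closeWith-μ⁺ x []      z = refl
foldl-closeWith-μ⁺ x (c ∷ w) z = trans (cong (λ t → foldl closeWith t w) (closeWith-μ⁺ x c z))
                                       (foldl-closeWith-μ⁺ x w (closeWith z c))

ψ-∷ : ∀ x w → ψ (x ∷ w) ≡ μ⁺ x (ψ w)
ψ-∷ a w = foldl-closeWith-μ⁺ a w []
ψ-∷ b w = foldl-closeWith-μ⁺ b w []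

count-a : Word → ℕ
count-a []      = 0
count-a (a ∷ w) = suc (count-a w)
count-a (b ∷ w) = count-a w

suc-count-a-μ⁺a : ∀ u → suc (count-a (μ⁺ a u)) ≡ suc (count-a u) + suc (count-b u)
suc-count-a-μ⁺a []      = refl
suc-count-a-μ⁺a (a ∷ u) = cong suc (suc-count-a-μ⁺a u)
suc-count-a-μ⁺a (b ∷ u) =
  trans (cong suc (suc-count-a-μ⁺a u)) (sym (+-suc (suc (count-a u)) (suc (count-b u))))

count-b-μ⁺a : ∀ u → count-b (μ⁺ a u) ≡ count-b u
count-b-μ⁺a []      = refl
count-b-μ⁺a (a ∷ u) = count-b-μ⁺a u
count-b-μ⁺a (b ∷ u) = cong suc (count-b-μ⁺a u)

count-a-μ⁺b : ∀ u → count-a (μ⁺ b u) ≡ count-a u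
count-a-μ⁺b []      = refl
count-a-μ⁺b (a ∷ u) = cong suc (count-a-μ⁺b u)
count-a-μ⁺b (b ∷ u) = count-a-μ⁺b u

suc-count-b-μ⁺b : ∀ u → suc (count-b (μ⁺ b u)) ≡ suc (count-a u) + suc (count-b u)
suc-count-b-μ⁺b []      = refl
suc-count-b-μ⁺b (a ∷ u) = cong suc (suc-count-b-μ⁺b u)
suc-count-b-μ⁺b (b ∷ u) =
  trans (cong suc (suc-count-b-μ⁺b u)) (sym (+-suc (suc (count-a u)) (suc (count-b u))))

mutual
  α : Word → ℕ
  α []      = 1
  α (a ∷ w) = α w + β w
  α (b ∷ w) = α w

  β : Word → ℕ
  β []      = 1
  β (a ∷ w) = β w
  β (b ∷ w) = α w + β w

suc-count-ψ : ∀ w → suc (count-a (ψ w)) ≡ α w × suc (count-b (ψ w)) ≡ β w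
suc-count-ψ []      = refl , refl
suc-count-ψ (a ∷ w) with suc-count-ψ w
... | αψ , βψ =
  trans (cong (suc ∘ count-a) (ψ-∷ a w)) (trans (suc-count-a-μ⁺a (ψ w)) (cong₂ _+_ αψ βψ)) ,
  trans (cong (suc ∘ count-b) (ψ-∷ a w)) (trans (cong suc (count-b-μ⁺a (ψ w))) βψ)
suc-count-ψ (b ∷ w) with suc-count-ψ w
... | αψ , βψ =
  trans (cong (suc ∘ count-a) (ψ-∷ b w)) (trans (cong suc (count-a-μ⁺b (ψ w))) αψ) ,
  trans (cong (suc ∘ count-b) (ψ-∷ b w)) (trans (suc-count-b-μ⁺b (ψ w)) (cong₂ _+_ αψ βψ))

Fm1-positive : ∀ n → 0 < Fm1 n
Fm1-positive zero          = s≤s z≤n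
Fm1-positive (suc zero)    = s≤s z≤n
Fm1-positive (suc (suc n)) = ≤-trans (Fm1-positive (suc n)) (m≤m+n _ _)

Fm1-increasing : ∀ n → Fm1 (suc n) < Fm1 (suc (suc n))
Fm1-increasing n = m<m+n (Fm1 (suc n)) (Fm1-positive n)

weights-≤-Fm1 : ∀ w → α w ≤ Fm1 (suc (length w)) × β w ≤ Fm1 (suc (length w))
                      × α w + β w ≤ Fm1 (suc (suc (length w)))
weights-≤-Fm1 []      = s≤s z≤n , s≤s z≤n , s≤s (s≤s z≤n)
weights-≤-Fm1 (a ∷ w) with weights-≤-Fm1 w
... | α≤ , β≤ , α+β≤ = α+β≤ , ≤-trans β≤ (<⇒≤ (Fm1-increasing (length w))) , +-mono-≤ α+β≤ β≤
weights-≤-Fm1 (b ∷ w) with weights-≤-Fm1 w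
... | α≤ , β≤ , α+β≤ = ≤-trans α≤ (<⇒≤ (Fm1-increasing (length w))) , α+β≤ ,
  ≤-trans (≤-reflexive (+-comm (α w) (α w + β w))) (+-mono-≤ α+β≤ α≤)

+-≤-tight : ∀ {m n o p} → m ≤ o → n ≤ p → m + n ≡ o + p → m ≡ o × n ≡ p
+-≤-tight {m} {n} {o} {p} m≤o n≤p eq = m≡o , +-cancelˡ-≡ o n p (trans (cong (_+ n) (sym m≡o)) eq)
  where
  m≡o : m ≡ o
  m≡o = ≤-antisym m≤o (+-cancelʳ-≤ p o m (≤-trans (≤-reflexive (sym eq)) (+-monoʳ-≤ m n≤p)))

alternating : Letter → ℕ → Word
alternating x zero    = []
alternating x (suc n) = x ∷ alternating (swapL x) n

mutual
  weights-alternating-a : ∀ k → α (alternating a k) ≡ Fm1 (suc k) × β (alternating a k) ≡ Fm1 k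
  weights-alternating-a zero    = refl , refl
  weights-alternating-a (suc k) with weights-alternating-b k
  ... | αk , βk = trans (cong₂ _+_ αk βk) (+-comm (Fm1 k) (Fm1 (suc k))) , βk

  weights-alternating-b : ∀ k → α (alternating b k) ≡ Fm1 k × β (alternating b k) ≡ Fm1 (suc k)
  weights-alternating-b zero    = refl , refl
  weights-alternating-b (suc k) with weights-alternating-a k
  ... | αk , βk = αk , cong₂ _+_ αk βk

Alternating : Word → Set
Alternating w = w ≡ alternating a (length w) ⊎ w ≡ alternating b (length w)

weight-sum-maximal : ∀ w → α w + β w ≡ Fm1 (suc (suc (length w))) → Alternating w
weight-sum-maximal []          _  = inj₁ refl
weight-sum-maximal (a ∷ [])    _  = inj₁ refl
weight-sum-maximal (b ∷ [])    _  = inj₂ refl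
weight-sum-maximal (a ∷ c ∷ w) eq = prepend (weight-sum-maximal (c ∷ w) (proj₁ tight))
  where
  tight : α (c ∷ w) + β (c ∷ w) ≡ Fm1 (suc (suc (suc (length w))))
          × β (c ∷ w) ≡ Fm1 (suc (suc (length w)))
  tight = +-≤-tight (proj₂ (proj₂ (weights-≤-Fm1 (c ∷ w)))) (proj₁ (proj₂ (weights-≤-Fm1 (c ∷ w))))
                    eq
  prepend : Alternating (c ∷ w) → Alternating (a ∷ c ∷ w)
  prepend (inj₂ cw≡) = inj₁ (cong (a ∷_) cw≡)
  prepend (inj₁ cw≡) = ⊥-elim (<-irrefl
    (trans (sym (proj₂ (weights-alternating-a (suc (length w))))) (trans (cong β (sym cw≡)) (proj₂ tight)))
    (Fm1-increasing (length w)))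
weight-sum-maximal (b ∷ c ∷ w) eq = prepend (weight-sum-maximal (c ∷ w) (proj₁ tight))
  where
  tight : α (c ∷ w) + β (c ∷ w) ≡ Fm1 (suc (suc (suc (length w))))
          × α (c ∷ w) ≡ Fm1 (suc (suc (length w)))
  tight = +-≤-tight (proj₂ (proj₂ (weights-≤-Fm1 (c ∷ w)))) (proj₁ (weights-≤-Fm1 (c ∷ w)))
    (trans (+-comm (α (c ∷ w) + β (c ∷ w)) (α (c ∷ w))) eq)
  prepend : Alternating (c ∷ w) → Alternating (b ∷ c ∷ w)
  prepend (inj₁ cw≡) = inj₂ (cong (b ∷_) cw≡)
  prepend (inj₂ cw≡) = ⊥-elim (<-irrefl
    (trans (sym (proj₁ (weights-alternating-b (suc (length w))))) (trans (cong α (sym cw≡)) (proj₂ tight)))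
    (Fm1-increasing (length w)))

abω-suc : ∀ i → abω (suc i) ≡ swapL (abω i)
abω-suc zero          = refl
abω-suc (suc zero)    = refl
abω-suc (suc (suc i)) = abω-suc i

applyUpTo-alternating : ∀ n (h : ℕ → Letter) → (∀ i → h (suc i) ≡ swapL (h i)) →
                        applyUpTo h n ≡ alternating (h 0) n
applyUpTo-alternating zero    h h-suc = refl
applyUpTo-alternating (suc n) h h-suc = cong (h 0 ∷_)
  (trans (applyUpTo-alternating n (h ∘ suc) (h-suc ∘ suc)) (cong (λ x → alternating x n) (h-suc 0)))

v⁽⁾-alternating : ∀ n → v⁽ n ⁾ ≡ alternating a n
v⁽⁾-alternating n = trans (map-applyUpTo (λ i → i) abω n) (applyUpTo-alternating n abω abω-suc)

E-alternating : ∀ x k → E (alternating x k) ≡ alternating (swapL x) k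
E-alternating x zero    = refl
E-alternating x (suc k) = cong (swapL x ∷_) (E-alternating (swapL x) k)

E-d-v⁽⁾ : ∀ k → E (d v⁽ suc (suc k) ⁾) ≡ a ∷ b ∷ alternating b k
E-d-v⁽⁾ k = trans (cong (E ∘ d) (v⁽⁾-alternating (suc (suc k))))
                  (cong (λ t → a ∷ b ∷ t) (E-alternating a k))

β-maximal⇔ : ∀ w → β w ≡ Fm1 (suc (length w)) ⇔
             (a ∷ w ≡ v⁽ suc (length w) ⁾ ⊎ a ∷ w ≡ E (d v⁽ suc (length w) ⁾))
β-maximal⇔ w = mk⇔ (to w) (from w)
  where
  to : ∀ w → β w ≡ Fm1 (suc (length w)) →
       a ∷ w ≡ v⁽ suc (length w) ⁾ ⊎ a ∷ w ≡ E (d v⁽ suc (length w) ⁾)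
  to []       _  = inj₁ refl
  to (a ∷ w′) eq = ⊥-elim (<-irrefl eq
    (≤-<-trans (proj₁ (proj₂ (weights-≤-Fm1 w′))) (Fm1-increasing (length w′))))
  to (b ∷ w′) eq with weight-sum-maximal w′ eq
  ... | inj₁ w′≡ = inj₁ (trans (cong (λ t → a ∷ b ∷ t) w′≡)
                               (sym (v⁽⁾-alternating (suc (suc (length w′))))))
  ... | inj₂ w′≡ = inj₂ (trans (cong (λ t → a ∷ b ∷ t) w′≡) (sym (E-d-v⁽⁾ (length w′))))
  from : ∀ w → a ∷ w ≡ v⁽ suc (length w) ⁾ ⊎ a ∷ w ≡ E (d v⁽ suc (length w) ⁾) →
         β w ≡ Fm1 (suc (length w))
  from w (inj₁ eq) = trans (cong β (∷-injectiveʳ (trans eq (v⁽⁾-alternating (suc (length w))))))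
                           (proj₂ (weights-alternating-b (length w)))
  from (c ∷ w′) (inj₂ eq) = begin
    β (c ∷ w′)                                      ≡⟨ cong β (∷-injectiveʳ (trans eq (E-d-v⁽⁾ k))) ⟩
    α (alternating b k) + β (alternating b k)       ≡⟨ cong₂ _+_ (proj₁ (weights-alternating-b k))
                                                                 (proj₂ (weights-alternating-b k)) ⟩
    Fm1 k + Fm1 (suc k)                             ≡⟨ +-comm (Fm1 k) (Fm1 (suc k)) ⟩
    Fm1 (suc (suc k))                               ∎
    where
    k : ℕ
    k = length w′

suc-count-b-ψ-v⁽⁾ : ∀ m → suc (count-b (ψ v⁽ suc m ⁾)) ≡ Fm1 (suc m)
suc-count-b-ψ-v⁽⁾ m = trans (cong (suc ∘ count-b ∘ ψ) (v⁽⁾-alternating (suc m)))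
  (trans (proj₂ (suc-count-ψ (a ∷ alternating b m))) (proj₂ (weights-alternating-b m)))

theorem4p8 : (n : ℕ) (v : Word) → length v ≡ n → head v ≡ just a →
    (count-b (ψ v) ≤ count-b (ψ v⁽ n ⁾))
    × (count-b (ψ v⁽ n ⁾) ≡ Fm1 n ∸ 1)
    × ((count-b (ψ v) ≡ count-b (ψ v⁽ n ⁾)) ⇔ ((v ≡ v⁽ n ⁾) ⊎ (v ≡ E (d v⁽ n ⁾))))
theorem4p8 n []      _    ()
theorem4p8 n (b ∷ w) _    ()
theorem4p8 _ (a ∷ w) refl refl =
  ≤-pred (subst₂ _≤_ (sym count-v) (sym count-V) (proj₁ (proj₂ (weights-≤-Fm1 w)))) ,
  cong (_∸ 1) count-V ,
  ⇔-trans count≡⇔β-maximal (β-maximal⇔ w)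
  where
  count-v : suc (count-b (ψ (a ∷ w))) ≡ β w
  count-v = proj₂ (suc-count-ψ (a ∷ w))
  count-V : suc (count-b (ψ v⁽ suc (length w) ⁾)) ≡ Fm1 (suc (length w))
  count-V = suc-count-b-ψ-v⁽⁾ (length w)
  count≡⇔β-maximal : count-b (ψ (a ∷ w)) ≡ count-b (ψ v⁽ suc (length w) ⁾) ⇔
                     β w ≡ Fm1 (suc (length w))
  count≡⇔β-maximal = mk⇔ (λ eq → trans (sym count-v) (trans (cong suc eq) count-V))
                         (λ eq → suc-injective (trans count-v (trans eq (sym count-V))))
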